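{- Let $m$ be a square-free positive integer and $p\nmid m$ a prime. Then every function computable by a $\mathsf{MOD}_m\circ\mathsf{AND}_d$-circuit can also be computed by a $\mathsf{MOD}_m\circ\Sigma_{p^1}$-circuit of size $O(m^{d+1})$.
   Context: Layers are listed from the input layer to the single output gate: a $\mathsf{MOD}_m\circ\mathsf{AND}_d$-circuit has $\mathsf{MOD}_m$ gates on the input variables feeding one $\mathsf{AND}_d$ output gate. A $\mathsf{MOD}_m$ gate has unbounded fan-in, sums its Boolean inputs modulo $m$ and outputs 1 iff the sum lies in an accepting set $T\subseteq\mathbb Z_m$ attached to that gate (different gates may have different sets). $\mathsf{AND}_d$ is a conjunction of at most $d$ inputs. A $\Sigma_{p^1}$ gate has unbounded fan-in and outputs $\alpha_1c_1+\dots+\alpha_rc_r+\delta\in\mathbb Z_p$ on Boolean inputs $c_i$, with arbitrary coefficients $\alpha_i,\delta\in\mathbb Z_p$. Multiple wires between gates are allowed. -}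

module Defs where

open import Data.Nat using (ℕ; zero; suc; _+_; _*_; _%_; _≤_; NonZero)
open import Data.Nat.DivMod using (_mod_)
open import Data.Nat.Divisibility using (_∣_)
open import Data.Fin using (Fin)
open import Data.Bool using (Bool; true; false; if_then_else_; _∧_)
open import Data.List using (List; []; _∷_; length)
open import Relation.Binary.PropositionalEquality using (_≡_)

SquareFree : ℕ → Set
SquareFree m = ∀ q → q * q ∣ m → q ≡ 1

sumFin : (n : ℕ) → (Fin n → ℕ) → ℕ
sumFin zero    f = 0
sumFin (suc n) f = f Fin.zero + sumFin n (λ i → f (Fin.suc i))

b2n : Bool → ℕ
b2n true  = 1
b2n false = 0

Input : ℕ → Set
Input n = Fin n → Bool

-- A MOD_m gate on the n input variables: wire multiplicities (multiple wires
-- allowed) and an accepting set T ⊆ ℤ_m.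
record ModGate (m n : ℕ) : Set where
  constructor modGate
  field
    wires  : Fin n → ℕ
    accept : Fin m → Bool

evalMod : ∀ {m n} .{{_ : NonZero m}} → ModGate m n → Input n → Bool
evalMod {m} {n} g x =
  ModGate.accept g (sumFin n (λ i → ModGate.wires g i * b2n (x i)) mod m)

-- MOD_m ∘ AND_d circuit: a list of at most d MOD_m gates feeding one AND gate.
record ModAndCircuit (m d n : ℕ) : Set where
  constructor modAnd
  field
    gates  : List (ModGate m n)
    fanin≤ : length gates ≤ d

allL : {A : Set} → (A → Bool) → List A → Bool
allL f []       = true
allL f (a ∷ as) = f a ∧ allL f as

evalModAnd : ∀ {m d n} .{{_ : NonZero m}} → ModAndCircuit m d n → Input n → Bool
evalModAnd c x = allL (λ g → evalMod g x) (ModAndCircuit.gates c)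

-- MOD_m ∘ Σ_{p^1} circuit: s MOD_m gates feeding one Σ_p output gate
-- computing α_1 c_1 + ... + α_s c_s + δ (mod p).
record ModSigmaCircuit (m p n : ℕ) : Set where
  constructor modSigma
  field
    size   : ℕ
    gates  : Fin size → ModGate m n
    coeffs : Fin size → ℕ
    const  : ℕ

evalModSigma : ∀ {m p n} .{{_ : NonZero m}} .{{_ : NonZero p}} →
               ModSigmaCircuit m p n → Input n → ℕ
evalModSigma {p = p} c x =
  (sumFin (ModSigmaCircuit.size c)
     (λ i → ModSigmaCircuit.coeffs c i * b2n (evalMod (ModSigmaCircuit.gates c i) x))
   + ModSigmaCircuit.const c) % p

-- A Σ_p gate sees the MOD_m gates below it only through an integer linear combination of
-- their outputs reduced mod p.  So it suffices to write the 0/1 value of the AND, modulo p, as an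
-- integer combination of indicators [⟨c, x⟩ ≡ r (mod m)] of linear forms in the inputs.
-- For a prime q ≠ p and residues modulo q,
--   q · [y ≡ a] [u ≡ b] = Σ_{t<q} [t y + u ≡ b + t a] + [y ≡ a] − 1 :
-- if y ≡ a every t contributes [u ≡ b], otherwise exactly one t contributes.  As q is invertible
-- mod p, [y ≡ a][u ≡ b] is such a combination; for square-free m the Chinese remainder theorem
-- multiplies these over the prime factors of m.  Absorbing the gates one at a time turns the AND
-- of k gates into a combination of indicators of linear forms in the k gate sums, and collecting
-- coefficients over the m^(k+1) normalised forms (c, r) ∈ ℤ_m^k × ℤ_m yields the circuit.

module Submission where

open import Data.Bool using (true; false; _∧_)
open import Data.Fin as Fin using (Fin; zero; suc; toℕ)
import Data.Fin.Properties as Finₚ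
open import Data.Integer using (ℤ; +_; -[1+_]; 0ℤ; 1ℤ; _+_; _*_; _-_; -_; ∣_∣; _%ℕ_; _/ℕ_)
import Data.Integer.Coprimality as ℤCoprime
open import Data.Integer.DivMod using (a≡a%ℕn+[a/ℕn]*n; n%ℕd<d)
import Data.Integer.Divisibility.Signed as ℤ∣
open ℤ∣ using (divides)
import Data.Integer.Properties as ℤₚ
open import Data.Integer.Tactic.RingSolver using (solve-∀)
open import Data.List using (List; []; _∷_; _++_; map; length; lookup; cartesianProductWith; allFin)
import Data.List.Properties as Listₚ
open import Data.List.Relation.Unary.All using (All; []; _∷_)
open import Data.Nat as ℕ using (ℕ; zero; suc; NonZero; _^_)
open import Data.Nat.Coprimality using (Coprime; coprime-Bézout)
open import Data.Nat.Divisibility as ℕ∣ using (_∣_)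
open import Data.Nat.GCD using (module Bézout)
open import Data.Nat.ListAction using (product)
open import Data.Nat.Primality
  using (Prime; euclidsLemma; prime⇒irreducible; prime⇒nonZero; prime⇒nonTrivial; ¬prime[1])
open import Data.Nat.Primality.Factorisation using (factorise; PrimeFactorisation)
open PrimeFactorisation using (isFactorisation; factorsPrime)
import Data.Nat.Properties as ℕₚ
import Data.Nat.Tactic.RingSolver as ℕSolver
open import Data.Product using (Σ; _,_; proj₁; proj₂; _×_)
open import Data.Sum using (inj₁; inj₂; [_,_]′)
open import Data.Vec as Vec using (Vec; []; _∷_)
open import Function using (_∘′_; id)
open import Function.Bundles using (_⇔_; mk⇔; Equivalence)
open import Level using (0ℓ)
open import Relation.Binary.Bundles using (Setoid)
open import Relation.Binary.PropositionalEquality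
  using (_≡_; refl; sym; trans; cong; cong₂; subst; module ≡-Reasoning)
import Relation.Binary.Reasoning.Setoid as SetoidReasoning
open import Relation.Nullary using (¬_; Dec; yes; no; does; contradiction)
open import Relation.Nullary.Decidable using (map′; _×-dec_)

open import Defs

-- Congruences of integers

infix 4 _≡_mod_ _≡?_mod_

-- A record rather than a synonym for divisibility, so that a and b can be inferred from a proof.
record _≡_mod_ (a b : ℤ) (N : ℕ) : Set where
  constructor mod-divides
  field
    divides-difference : + N ℤ∣.∣ a - b

open _≡_mod_ public

_≡?_mod_ : ∀ a b N → Dec (a ≡ b mod N)
a ≡? b mod N = map′ mod-divides divides-difference (+ N ℤ∣.∣? a - b)

private
  negate-difference : ∀ a b → - (a - b) ≡ b - a
  negate-difference = solve-∀
  add-differences : ∀ a b c d → (a - b) + (c - d) ≡ (a + c) - (b + d)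
  add-differences = solve-∀
  multiply-differences : ∀ a b c d → a * (c - d) + (a - b) * d ≡ a * c - b * d
  multiply-differences = solve-∀
  negate-distrib-difference : ∀ a b → - (a - b) ≡ - a - - b
  negate-distrib-difference = solve-∀
  difference-of-differences : ∀ a b c d → (a - b) - ((a - b) - (c - d)) ≡ c - d
  difference-of-differences = solve-∀

module _ {N : ℕ} where

  private
    transport : ∀ {x c d} → + N ℤ∣.∣ x → x ≡ c - d → c ≡ d mod N
    transport p e = mod-divides (subst (+ N ℤ∣.∣_) e p)

  ≡⇒≡mod : ∀ {a b} → a ≡ b → a ≡ b mod N
  ≡⇒≡mod {a} refl = mod-divides (divides 0ℤ (trans (ℤₚ.+-inverseʳ a) (sym (ℤₚ.*-zeroˡ (+ N)))))

  ≡mod-refl : ∀ {a} → a ≡ a mod N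
  ≡mod-refl = ≡⇒≡mod refl

  ≡mod-sym : ∀ {a b} → a ≡ b mod N → b ≡ a mod N
  ≡mod-sym {a} {b} (mod-divides p) = transport (ℤ∣.∣m⇒∣-m p) (negate-difference a b)

  ≡mod-trans : ∀ {a b c} → a ≡ b mod N → b ≡ c mod N → a ≡ c mod N
  ≡mod-trans {a} {b} {c} (mod-divides p) (mod-divides q) =
    transport (ℤ∣.∣m∣n⇒∣m+n p q) (ℤₚ.+-minus-telescope a b c)

  +-cong-mod : ∀ {a b c d} → a ≡ b mod N → c ≡ d mod N → a + c ≡ b + d mod N
  +-cong-mod {a} {b} {c} {d} (mod-divides p) (mod-divides q) =
    transport (ℤ∣.∣m∣n⇒∣m+n p q) (add-differences a b c d)

  *-cong-mod : ∀ {a b c d} → a ≡ b mod N → c ≡ d mod N → a * c ≡ b * d mod N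
  *-cong-mod {a} {b} {c} {d} (mod-divides p) (mod-divides q) =
    transport (ℤ∣.∣m∣n⇒∣m+n (ℤ∣.∣n⇒∣m*n a q) (ℤ∣.∣m⇒∣m*n d p)) (multiply-differences a b c d)

  -‿cong-mod : ∀ {a b} → a ≡ b mod N → - a ≡ - b mod N
  -‿cong-mod {a} {b} (mod-divides p) = transport (ℤ∣.∣m⇒∣-m p) (negate-distrib-difference a b)

  ≡mod-difference : ∀ {a b c d} → a - b ≡ c - d mod N → a ≡ b mod N → c ≡ d mod N
  ≡mod-difference {a} {b} {c} {d} (mod-divides p) (mod-divides q) =
    transport (ℤ∣.∣m∣n⇒∣m-n q p) (difference-of-differences a b c d)

  multiple≡0-mod : ∀ k → k * + N ≡ 0ℤ mod N
  multiple≡0-mod k = mod-divides (divides k (ℤₚ.+-identityʳ (k * + N)))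

≡mod-setoid : ℕ → Setoid 0ℓ 0ℓ
≡mod-setoid N = record
  { Carrier       = ℤ
  ; _≈_           = λ a b → a ≡ b mod N
  ; isEquivalence = record { refl = ≡mod-refl ; sym = ≡mod-sym ; trans = ≡mod-trans }
  }

module ≡mod-Reasoning (N : ℕ) = SetoidReasoning (≡mod-setoid N)

≡mod-∣ : ∀ {N M a b} → N ∣ M → a ≡ b mod M → a ≡ b mod N
≡mod-∣ N∣M (mod-divides p) = mod-divides (ℤ∣.∣-trans (ℤ∣.∣ᵤ⇒∣ N∣M) p)

≡mod-1 : ∀ a b → a ≡ b mod 1
≡mod-1 a b = mod-divides (ℤ∣.∣ᵤ⇒∣ (ℕ∣.1∣ _))

∣∧<⇒≡0 : ∀ {N k} → N ∣ k → k ℕ.< N → k ≡ 0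
∣∧<⇒≡0 {k = zero}  _   _   = refl
∣∧<⇒≡0 {k = suc _} N∣k k<N = contradiction N∣k (ℕ∣.>⇒∤ k<N)

<∧≡mod⇒≡ : ∀ {N i j} → i ℕ.< N → j ℕ.< N → + i ≡ + j mod N → i ≡ j
<∧≡mod⇒≡ {N} {i} {j} i<N j<N (mod-divides N∣i-j) =
  ℤₚ.+-injective (ℤₚ.i-j≡0⇒i≡j (+ i) (+ j) (ℤₚ.∣i∣≡0⇒i≡0 (∣∧<⇒≡0 (ℤ∣.∣⇒∣ᵤ N∣i-j) ∣i-j∣<N)))
  where
  ∣i-j∣<N : ∣ + i - + j ∣ ℕ.< N
  ∣i-j∣<N = ℕₚ.≤-<-trans (subst (ℕ._≤ i ℕ.⊔ j) (cong ∣_∣ (sym (ℤₚ.m-n≡m⊖n i j))) (ℤₚ.∣m⊝n∣≤m⊔n i j))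
                         (ℕₚ.⊔-lub i<N j<N)

module _ {N : ℕ} .{{_ : NonZero N}} where

  -- On a natural X, residue (+ X) is definitionally X mod N, the reduction evalMod performs.
  residue : ℤ → Fin N
  residue a = Fin.fromℕ< (n%ℕd<d a N)

  residue-≡mod : ∀ a → + toℕ (residue a) ≡ a mod N
  residue-≡mod a = mod-divides (divides (- (a /ℕ N)) (begin
    + toℕ (residue a) - a               ≡⟨ cong₂ (λ r x → + r - x) (Finₚ.toℕ-fromℕ< _) (a≡a%ℕn+[a/ℕn]*n a N) ⟩
    r - (r + q * + N)                   ≡⟨ cancel r q (+ N) ⟩
    - q * + N                           ∎))
    where
    open ≡-Reasoning
    r = + (a %ℕ N)
    q = a /ℕ N
    cancel : ∀ r q n → r - (r + q * n) ≡ - q * n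
    cancel = solve-∀

  residue-unique : ∀ {a} {i : Fin N} → a ≡ + toℕ i mod N → residue a ≡ i
  residue-unique {a} {i} a≡i = Finₚ.toℕ-injective (<∧≡mod⇒≡ (Finₚ.toℕ<n (residue a)) (Finₚ.toℕ<n i)
    (≡mod-trans (residue-≡mod a) a≡i))

  residue≡⇔≡mod : ∀ {a} {i : Fin N} → (residue a ≡ i) ⇔ (a ≡ + toℕ i mod N)
  residue≡⇔≡mod {a} = mk⇔ (λ { refl → ≡mod-sym (residue-≡mod a) }) residue-unique

  %-≡mod⇒≡ : ∀ {X Y} → Y ℕ.< N → + X ≡ + Y mod N → X ℕ.% N ≡ Y
  %-≡mod⇒≡ {X} Y<N X≡Y = trans (sym (Finₚ.toℕ-fromℕ< _))
    (<∧≡mod⇒≡ (Finₚ.toℕ<n (residue (+ X))) Y<N (≡mod-trans (residue-≡mod (+ X)) X≡Y))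

prime∤⇒coprime : ∀ {q n} → Prime q → ¬ q ∣ n → Coprime q n
prime∤⇒coprime pq q∤n (d∣q , d∣n) with prime⇒irreducible pq d∣q
... | inj₁ d≡1 = d≡1
... | inj₂ refl = contradiction d∣n q∤n

∣∣⇒≡0-mod : ∀ {N w} → N ∣ ∣ w ∣ → w ≡ 0ℤ mod N
∣∣⇒≡0-mod {N} {w} N∣w = mod-divides (subst (+ N ℤ∣.∣_) (sym (ℤₚ.+-identityʳ w)) (ℤ∣.∣ᵤ⇒∣ N∣w))

prime-*-cancelʳ : ∀ {q x y w} → Prime q → ¬ (w ≡ 0ℤ mod q) → x * w ≡ y * w mod q → x ≡ y mod q
prime-*-cancelʳ {q} {x} {y} {w} pq w≢0 (mod-divides q∣xw-yw) =
  [ mod-divides ∘′ ℤ∣.∣ᵤ⇒∣ , (λ q∣w → contradiction (∣∣⇒≡0-mod q∣w) w≢0) ]′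
    (euclidsLemma ∣ x - y ∣ ∣ w ∣ pq (subst (q ∣_) (ℤₚ.abs-* (x - y) w) (ℤ∣.∣⇒∣ᵤ q∣[x-y]w)))
  where
  factor : ∀ x y w → x * w - y * w ≡ (x - y) * w
  factor = solve-∀
  q∣[x-y]w : + q ℤ∣.∣ (x - y) * w
  q∣[x-y]w = subst (+ q ℤ∣.∣_) (factor x y w) q∣xw-yw

private
  Bézout-cast : ∀ a b c d → 1 ℕ.+ a ℕ.* b ≡ c ℕ.* d → 1ℤ + + a * + b ≡ + c * + d
  Bézout-cast a b c d e = begin
    1ℤ + + a * + b       ≡⟨ cong (λ z → 1ℤ + z) (ℤₚ.pos-* a b) ⟨
    + (1 ℕ.+ a ℕ.* b)    ≡⟨ cong +_ e ⟩
    + (c ℕ.* d)          ≡⟨ ℤₚ.pos-* c d ⟩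
    + c * + d            ∎
    where open ≡-Reasoning

coprime⇒inverse : ∀ {m n} → Coprime m n → Σ ℤ λ u → u * + n ≡ 1ℤ mod m
coprime⇒inverse {m} {n} c with coprime-Bézout c
... | Bézout.+- x y 1+yn≡xm = - + y , mod-divides (divides (- + x) (begin
  - + y * + n - 1ℤ        ≡⟨ negate (+ y) (+ n) ⟩
  - (1ℤ + + y * + n)      ≡⟨ cong -_ (Bézout-cast y n x m 1+yn≡xm) ⟩
  - (+ x * + m)           ≡⟨ ℤₚ.neg-distribˡ-* (+ x) (+ m) ⟩
  - + x * + m             ∎))
  where
  open ≡-Reasoning
  negate : ∀ y n → - y * n - 1ℤ ≡ - (1ℤ + y * n)
  negate = solve-∀
... | Bézout.-+ x y 1+xm≡yn = + y , mod-divides (divides (+ x) (begin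
  + y * + n - 1ℤ          ≡⟨ cong (_- 1ℤ) (Bézout-cast x m y n 1+xm≡yn) ⟨
  1ℤ + + x * + m - 1ℤ     ≡⟨ cancel (+ x * + m) ⟩
  + x * + m               ∎))
  where
  open ≡-Reasoning
  cancel : ∀ k → 1ℤ + k - 1ℤ ≡ k
  cancel = solve-∀

prime⇒inverse : ∀ {q w} → Prime q → ¬ (w ≡ 0ℤ mod q) → Σ ℤ λ z → z * w ≡ 1ℤ mod q
prime⇒inverse {q} {+ n} pq w≢0 = coprime⇒inverse (prime∤⇒coprime pq (w≢0 ∘′ ∣∣⇒≡0-mod))
prime⇒inverse {q} { -[1+ n ]} pq w≢0 with coprime⇒inverse (prime∤⇒coprime pq (w≢0 ∘′ ∣∣⇒≡0-mod))
... | u , u*[1+n]≡1 = - u , subst (λ z → z ≡ 1ℤ mod q) (sym (negate-both u (+ suc n))) u*[1+n]≡1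
  where
  negate-both : ∀ u k → - u * - k ≡ u * k
  negate-both = solve-∀

coprime⇒≡mod-* : ∀ {q M a b} → Coprime q M → a ≡ b mod q → a ≡ b mod M → a ≡ b mod q ℕ.* M
coprime⇒≡mod-* {q} {M} {a} {b} c (mod-divides q∣a-b) (mod-divides (divides k a-b≡kM)) =
  mod-divides (divides j (begin
    a - b              ≡⟨ a-b≡kM ⟩
    k * + M            ≡⟨ cong (_* + M) k≡jq ⟩
    j * + q * + M      ≡⟨ ℤₚ.*-assoc j (+ q) (+ M) ⟩
    j * (+ q * + M)    ≡⟨ cong (j *_) (ℤₚ.pos-* q M) ⟨
    j * + (q ℕ.* M)    ∎))
  where
  open ≡-Reasoning
  q∣k : + q ℤ∣.∣ k
  q∣k = ℤ∣.∣ᵤ⇒∣ (ℤCoprime.coprime-divisor (+ q) (+ M) k c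
          (ℤ∣.∣⇒∣ᵤ (subst (+ q ℤ∣.∣_) (trans a-b≡kM (ℤₚ.*-comm k (+ M))) q∣a-b)))
  j = ℤ∣._∣_.quotient q∣k
  k≡jq = ℤ∣._∣_.equality q∣k

-- Iverson brackets

𝟙 : {P : Set} → Dec P → ℤ
𝟙 (yes _) = 1ℤ
𝟙 (no  _) = 0ℤ

module _ {P : Set} where

  𝟙-yes : P → (p? : Dec P) → 𝟙 p? ≡ 1ℤ
  𝟙-yes p (yes _) = refl
  𝟙-yes p (no ¬p) = contradiction p ¬p

  𝟙-no : ¬ P → (p? : Dec P) → 𝟙 p? ≡ 0ℤ
  𝟙-no ¬p (yes p) = contradiction p ¬p
  𝟙-no ¬p (no _)  = refl

module _ {P Q : Set} where

  𝟙-⇔ : P ⇔ Q → (p? : Dec P) (q? : Dec Q) → 𝟙 p? ≡ 𝟙 q?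
  𝟙-⇔ P⇔Q (yes p) q? = sym (𝟙-yes (Equivalence.to P⇔Q p) q?)
  𝟙-⇔ P⇔Q (no ¬p) q? = sym (𝟙-no (¬p ∘′ Equivalence.from P⇔Q) q?)

  𝟙-×-dec : (p? : Dec P) (q? : Dec Q) → 𝟙 (p? ×-dec q?) ≡ 𝟙 p? * 𝟙 q?
  𝟙-×-dec (yes _) (yes _) = refl
  𝟙-×-dec (yes _) (no _)  = refl
  𝟙-×-dec (no _)  q?      = sym (ℤₚ.*-zeroˡ (𝟙 q?))

𝟙-map′ : ∀ {P Q : Set} {f : P → Q} {g : Q → P} (p? : Dec P) → 𝟙 (map′ f g p?) ≡ 𝟙 p?
𝟙-map′ (yes _) = refl
𝟙-map′ (no _)  = refl

𝟙[_≡_mod_] : ℤ → ℤ → ℕ → ℤ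
𝟙[ a ≡ b mod N ] = 𝟙 (a ≡? b mod N)

module _ {N : ℕ} where

  𝟙≡mod-⇔ : ∀ {a b c d M} → (a ≡ b mod N) ⇔ (c ≡ d mod M) → 𝟙[ a ≡ b mod N ] ≡ 𝟙[ c ≡ d mod M ]
  𝟙≡mod-⇔ {a} {b} {c} {d} {M} eqv = 𝟙-⇔ eqv (a ≡? b mod N) (c ≡? d mod M)

  𝟙≡mod-cong : ∀ {a a′ b b′} → a ≡ a′ mod N → b ≡ b′ mod N → 𝟙[ a ≡ b mod N ] ≡ 𝟙[ a′ ≡ b′ mod N ]
  𝟙≡mod-cong a≡a′ b≡b′ = 𝟙≡mod-⇔ (mk⇔
    (λ a≡b → ≡mod-trans (≡mod-sym a≡a′) (≡mod-trans a≡b b≡b′))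
    (λ a′≡b′ → ≡mod-trans a≡a′ (≡mod-trans a′≡b′ (≡mod-sym b≡b′))))

  𝟙≡mod-difference : ∀ {a b c d} → a - b ≡ c - d mod N → 𝟙[ a ≡ b mod N ] ≡ 𝟙[ c ≡ d mod N ]
  𝟙≡mod-difference e = 𝟙≡mod-⇔ (mk⇔ (≡mod-difference e) (≡mod-difference (≡mod-sym e)))

𝟙≡mod-1 : ∀ a b → 𝟙[ a ≡ b mod 1 ] ≡ 1ℤ
𝟙≡mod-1 a b = 𝟙-yes (≡mod-1 a b) (a ≡? b mod 1)

𝟙≡mod-*-coprime : ∀ {q M} → Coprime q M → ∀ a b →
                  𝟙[ a ≡ b mod q ℕ.* M ] ≡ 𝟙[ a ≡ b mod q ] * 𝟙[ a ≡ b mod M ]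
𝟙≡mod-*-coprime {q} {M} c a b = trans
  (𝟙-⇔ (mk⇔ (λ e → ≡mod-∣ (ℕ∣.m∣m*n M) e , ≡mod-∣ (ℕ∣.n∣m*n q) e) (λ (e , f) → coprime⇒≡mod-* c e f))
       (a ≡? b mod q ℕ.* M) ((a ≡? b mod q) ×-dec (a ≡? b mod M)))
  (𝟙-×-dec (a ≡? b mod q) (a ≡? b mod M))

∑ : {A : Set} → List A → (A → ℤ) → ℤ
∑ []       f = 0ℤ
∑ (a ∷ as) f = f a + ∑ as f

infix 5 ∑
syntax ∑ xs (λ x → e) = ∑[ x ∈ xs ] e

module _ {A : Set} where

  ∑-cong : ∀ (xs : List A) {f g} → (∀ x → f x ≡ g x) → ∑ xs f ≡ ∑ xs g
  ∑-cong []       f≡g = refl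
  ∑-cong (x ∷ xs) f≡g = cong₂ _+_ (f≡g x) (∑-cong xs f≡g)

  ∑-cong-mod : ∀ {N} (xs : List A) {f g} → (∀ x → f x ≡ g x mod N) → ∑ xs f ≡ ∑ xs g mod N
  ∑-cong-mod []       f≡g = ≡mod-refl
  ∑-cong-mod (x ∷ xs) f≡g = +-cong-mod (f≡g x) (∑-cong-mod xs f≡g)

  ∑-++ : ∀ (xs ys : List A) f → ∑ (xs ++ ys) f ≡ ∑ xs f + ∑ ys f
  ∑-++ []       ys f = sym (ℤₚ.+-identityˡ (∑ ys f))
  ∑-++ (x ∷ xs) ys f = trans (cong (_+_ (f x)) (∑-++ xs ys f)) (sym (ℤₚ.+-assoc (f x) _ _))

  ∑-*ˡ : ∀ c (xs : List A) f → c * ∑ xs f ≡ ∑[ x ∈ xs ] c * f x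
  ∑-*ˡ c []       f = ℤₚ.*-zeroʳ c
  ∑-*ˡ c (x ∷ xs) f = trans (ℤₚ.*-distribˡ-+ c (f x) _) (cong (_+_ (c * f x)) (∑-*ˡ c xs f))

  ∑-*ʳ : ∀ c (xs : List A) f → ∑ xs f * c ≡ ∑[ x ∈ xs ] f x * c
  ∑-*ʳ c xs f = trans (ℤₚ.*-comm (∑ xs f) c)
    (trans (∑-*ˡ c xs f) (∑-cong xs (λ x → ℤₚ.*-comm c (f x))))

  ∑-const : ∀ (xs : List A) c → ∑[ _ ∈ xs ] c ≡ + length xs * c
  ∑-const []       c = sym (ℤₚ.*-zeroˡ c)
  ∑-const (x ∷ xs) c = begin
    c + (∑[ _ ∈ xs ] c)       ≡⟨ cong (_+_ c) (∑-const xs c) ⟩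
    c + + length xs * c       ≡⟨ cong (_+ + length xs * c) (ℤₚ.*-identityˡ c) ⟨
    1ℤ * c + + length xs * c  ≡⟨ ℤₚ.*-distribʳ-+ c 1ℤ (+ length xs) ⟨
    + suc (length xs) * c     ∎
    where open ≡-Reasoning

  ∑-+ : ∀ (xs : List A) f g → ∑[ x ∈ xs ] (f x + g x) ≡ ∑ xs f + ∑ xs g
  ∑-+ []       f g = refl
  ∑-+ (x ∷ xs) f g = trans (cong (_+_ (f x + g x)) (∑-+ xs f g)) (interchange (f x) (g x) (∑ xs f) (∑ xs g))
    where
    interchange : ∀ a b c d → a + b + (c + d) ≡ a + c + (b + d)
    interchange = solve-∀

  ∑-0 : ∀ (xs : List A) f → (∀ x → f x ≡ 0ℤ) → ∑ xs f ≡ 0ℤ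
  ∑-0 xs f f≡0 = trans (∑-cong xs f≡0) (trans (∑-const xs 0ℤ) (ℤₚ.*-zeroʳ (+ length xs)))

module _ {A B : Set} where

  ∑-map : ∀ (g : A → B) xs f → ∑ (map g xs) f ≡ ∑[ x ∈ xs ] f (g x)
  ∑-map g []       f = refl
  ∑-map g (x ∷ xs) f = cong (_+_ (f (g x))) (∑-map g xs f)

  ∑-swap : ∀ (xs : List A) (ys : List B) (f : A → B → ℤ) →
           ∑[ x ∈ xs ] ∑[ y ∈ ys ] f x y ≡ ∑[ y ∈ ys ] ∑[ x ∈ xs ] f x y
  ∑-swap []       ys f = sym (∑-0 ys (λ _ → 0ℤ) (λ _ → refl))
  ∑-swap (x ∷ xs) ys f =
    trans (cong (_+_ (∑ ys (f x))) (∑-swap xs ys f)) (sym (∑-+ ys (f x) (λ y → ∑[ x′ ∈ xs ] f x′ y)))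

  ∑-*-∑ : ∀ (xs : List A) (ys : List B) (f : A → ℤ) (g : B → ℤ) →
          ∑ xs f * ∑ ys g ≡ ∑[ x ∈ xs ] ∑[ y ∈ ys ] f x * g y
  ∑-*-∑ xs ys f g = trans (∑-*ʳ (∑ ys g) xs f) (∑-cong xs (λ x → ∑-*ˡ (f x) ys g))

module _ {A B C : Set} (g : A → B → C) where

  ∑-cartesianProductWith : ∀ xs ys (f : C → ℤ) →
    ∑ (cartesianProductWith g xs ys) f ≡ ∑[ x ∈ xs ] ∑[ y ∈ ys ] f (g x y)
  ∑-cartesianProductWith []       ys f = refl
  ∑-cartesianProductWith (x ∷ xs) ys f = trans (∑-++ (map (g x) ys) _ f)
    (cong₂ _+_ (∑-map (g x) ys f) (∑-cartesianProductWith xs ys f))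

  length-cartesianProductWith : ∀ xs ys → length (cartesianProductWith g xs ys) ≡ length xs ℕ.* length ys
  length-cartesianProductWith []       ys = refl
  length-cartesianProductWith (x ∷ xs) ys = trans (Listₚ.length-++ (map (g x) ys))
    (cong₂ ℕ._+_ (Listₚ.length-map (g x) ys) (length-cartesianProductWith xs ys))

-- Enumerations of finite types

record Enumeration (A : Set) : Set where
  field
    elements : List A
    δ        : A → A → ℤ
    sift     : ∀ (h : A → ℤ) j → ∑[ a ∈ elements ] h a * δ j a ≡ h j

open Enumeration

module _ {A B C : Set} (E : Enumeration A) (F : Enumeration B) (g : A → B → C) where

  sift-cartesianProductWith : ∀ (δ′ : C → C → ℤ) → (∀ j k a b → δ′ (g j k) (g a b) ≡ δ E j a * δ F k b) →
    ∀ (h : C → ℤ) j k → ∑[ c ∈ cartesianProductWith g (elements E) (elements F) ] h c * δ′ (g j k) c ≡ h (g j k)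
  sift-cartesianProductWith δ′ δ′-split h j k = begin
    ∑[ c ∈ cartesianProductWith g (elements E) (elements F) ] h c * δ′ (g j k) c
      ≡⟨ ∑-cartesianProductWith g (elements E) (elements F) _ ⟩
    ∑[ a ∈ elements E ] ∑[ b ∈ elements F ] h (g a b) * δ′ (g j k) (g a b)
      ≡⟨ ∑-cong (elements E) (λ a → ∑-cong (elements F) (λ b →
           trans (cong (h (g a b) *_) (δ′-split j k a b)) (rearrange (h (g a b)) _ _))) ⟩
    ∑[ a ∈ elements E ] ∑[ b ∈ elements F ] h (g a b) * δ F k b * δ E j a
      ≡⟨ ∑-cong (elements E) (λ a → ∑-*ʳ (δ E j a) (elements F) _) ⟨
    ∑[ a ∈ elements E ] (∑[ b ∈ elements F ] h (g a b) * δ F k b) * δ E j a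
      ≡⟨ ∑-cong (elements E) (λ a → cong (_* δ E j a) (sift F (h ∘′ g a) k)) ⟩
    ∑[ a ∈ elements E ] h (g a k) * δ E j a
      ≡⟨ sift E (λ a → h (g a k)) j ⟩
    h (g j k) ∎
    where
    open ≡-Reasoning
    rearrange : ∀ x y z → x * (y * z) ≡ x * z * y
    rearrange = solve-∀


_×ᴱ_ : {A B : Set} → Enumeration A → Enumeration B → Enumeration (A × B)
E ×ᴱ F = record
  { elements = cartesianProductWith _,_ (elements E) (elements F)
  ; δ        = δ×
  ; sift     = λ h (j , k) → sift-cartesianProductWith E F _,_ δ× (λ _ _ _ _ → refl) h j k
  }
  where
  δ× : _ → _ → ℤ
  δ× (j , k) (a , b) = δ E j a * δ F k b

vecᴱ : {A : Set} → Enumeration A → ∀ k → Enumeration (Vec A k)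
vecᴱ E zero = record
  { elements = [] ∷ []
  ; δ        = λ _ _ → 1ℤ
  ; sift     = λ { h [] → trans (ℤₚ.+-identityʳ (h [] * 1ℤ)) (ℤₚ.*-identityʳ (h [])) }
  }
vecᴱ E (suc k) = record
  { elements = cartesianProductWith _∷_ (elements E) (elements (vecᴱ E k))
  ; δ        = δ∷
  ; sift     = λ { h (j ∷ js) → sift-cartesianProductWith E (vecᴱ E k) _∷_ δ∷ (λ _ _ _ _ → refl) h j js }
  }
  where
  δ∷ : Vec _ (suc k) → Vec _ (suc k) → ℤ
  δ∷ (j ∷ js) (a ∷ as) = δ E j a * δ (vecᴱ E k) js as

sift-allFin : ∀ n (h : Fin n → ℤ) j → ∑[ a ∈ allFin n ] h a * 𝟙 (j Finₚ.≟ a) ≡ h j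
sift-allFin (suc n) h j = begin
  ∑[ a ∈ allFin (suc n) ] h a * δ′ j a
    ≡⟨ cong (λ as → h zero * δ′ j zero + ∑ as (λ a → h a * δ′ j a)) (Listₚ.map-tabulate id suc) ⟨
  h zero * δ′ j zero + (∑[ a ∈ map suc (allFin n) ] h a * δ′ j a)
    ≡⟨ cong (_+_ (h zero * δ′ j zero)) (∑-map suc (allFin n) (λ a → h a * δ′ j a)) ⟩
  h zero * δ′ j zero + (∑[ a ∈ allFin n ] h (suc a) * δ′ j (suc a))
    ≡⟨ split j ⟩
  h j ∎
  where
  open ≡-Reasoning
  δ′ : ∀ {n} → Fin n → Fin n → ℤ
  δ′ j a = 𝟙 (j Finₚ.≟ a)
  split : ∀ j → h zero * δ′ j zero + (∑[ a ∈ allFin n ] h (suc a) * δ′ j (suc a)) ≡ h j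
  split zero    = trans (cong₂ _+_ (ℤₚ.*-identityʳ (h zero)) (∑-0 (allFin n) _ (λ a → ℤₚ.*-zeroʳ (h (suc a)))))
                        (ℤₚ.+-identityʳ (h zero))
  split (suc j) = begin
    h zero * 0ℤ + (∑[ a ∈ allFin n ] h (suc a) * δ′ (suc j) (suc a))
      ≡⟨ cong (_+ (∑[ a ∈ allFin n ] h (suc a) * δ′ (suc j) (suc a))) (ℤₚ.*-zeroʳ (h zero)) ⟩
    0ℤ + (∑[ a ∈ allFin n ] h (suc a) * δ′ (suc j) (suc a))
      ≡⟨ ℤₚ.+-identityˡ _ ⟩
    ∑[ a ∈ allFin n ] h (suc a) * δ′ (suc j) (suc a)
      ≡⟨ ∑-cong (allFin n) (λ a → cong (h (suc a) *_) (𝟙-map′ (j Finₚ.≟ a))) ⟩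
    ∑[ a ∈ allFin n ] h (suc a) * δ′ j a
      ≡⟨ sift-allFin n (h ∘′ suc) j ⟩
    h (suc j) ∎

finᴱ : ∀ n → Enumeration (Fin n)
finᴱ n = record { elements = allFin n ; δ = λ j a → 𝟙 (j Finₚ.≟ a) ; sift = sift-allFin n }

-- Integer combinations modulo p

lincomb : {A X : Set} → (A → X → ℤ) → List (ℤ × A) → X → ℤ
lincomb ev L x = ∑ L (λ (μ , a) → μ * ev a x)

record InSpan {A X : Set} (p : ℕ) (ev : A → X → ℤ) (F : X → ℤ) : Set where
  constructor spanned-by
  field
    combination : List (ℤ × A)
    represents  : ∀ x → F x ≡ lincomb ev combination x mod p

open InSpan

module _ {p : ℕ} {A X : Set} {ev : A → X → ℤ} where

  atom-InSpan : ∀ a → InSpan p ev (ev a)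
  atom-InSpan a = spanned-by ((1ℤ , a) ∷ [])
    (λ x → ≡⇒≡mod (sym (trans (ℤₚ.+-identityʳ (1ℤ * ev a x)) (ℤₚ.*-identityˡ (ev a x)))))

  InSpan-resp : ∀ {F G} → (∀ x → F x ≡ G x mod p) → InSpan p ev G → InSpan p ev F
  InSpan-resp F≡G (spanned-by L G≡L) = spanned-by L (λ x → ≡mod-trans (F≡G x) (G≡L x))

  +-InSpan : ∀ {F G} → InSpan p ev F → InSpan p ev G → InSpan p ev (λ x → F x + G x)
  +-InSpan (spanned-by L F≡L) (spanned-by K G≡K) = spanned-by (L ++ K) λ x →
    ≡mod-trans (+-cong-mod (F≡L x) (G≡K x)) (≡⇒≡mod (sym (∑-++ L K (λ (μ , a) → μ * ev a x))))

  *-InSpan : ∀ c {F} → InSpan p ev F → InSpan p ev (λ x → c * F x)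
  *-InSpan c (spanned-by L F≡L) = spanned-by (map (λ (μ , a) → c * μ , a) L) λ x →
    ≡mod-trans (*-cong-mod (≡mod-refl {a = c}) (F≡L x)) (≡⇒≡mod (begin
      c * lincomb ev L x                           ≡⟨ ∑-*ˡ c L (λ (μ , a) → μ * ev a x) ⟩
      ∑[ (μ , a) ∈ L ] c * (μ * ev a x)            ≡⟨ ∑-cong L (λ (μ , a) → sym (ℤₚ.*-assoc c μ (ev a x))) ⟩
      ∑[ (μ , a) ∈ L ] c * μ * ev a x              ≡⟨ ∑-map (λ (μ , a) → c * μ , a) L (λ (μ , a) → μ * ev a x) ⟨
      lincomb ev (map (λ (μ , a) → c * μ , a) L) x ∎))
    where open ≡-Reasoning

  ∑-InSpan : ∀ {I : Set} (is : List I) {F : I → X → ℤ} → (∀ i → InSpan p ev (F i)) →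
             InSpan p ev (λ x → ∑[ i ∈ is ] F i x)
  ∑-InSpan []       F-InSpan = spanned-by [] (λ _ → ≡mod-refl)
  ∑-InSpan (i ∷ is) F-InSpan = +-InSpan (F-InSpan i) (∑-InSpan is F-InSpan)

module _ {p : ℕ} {A B X Y : Set} {evA : A → Y → ℤ} {evB : B → X → ℤ} where

  InSpan-subst : ∀ (h : A → B) (φ : X → Y) → (∀ a x → evA a (φ x) ≡ evB (h a) x) →
                 ∀ {F} → InSpan p evA F → InSpan p evB (F ∘′ φ)
  InSpan-subst h φ h-φ (spanned-by L F≡L) = spanned-by (map (λ (μ , a) → μ , h a) L) λ x →
    ≡mod-trans (F≡L (φ x)) (≡⇒≡mod (begin
      lincomb evA L (φ x)                         ≡⟨ ∑-cong L (λ (μ , a) → cong (μ *_) (h-φ a x)) ⟩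
      ∑[ (μ , a) ∈ L ] μ * evB (h a) x             ≡⟨ ∑-map (λ (μ , a) → μ , h a) L (λ (μ , b) → μ * evB b x) ⟨
      lincomb evB (map (λ (μ , a) → μ , h a) L) x ∎))
    where open ≡-Reasoning

module _ {p : ℕ} {A B C X : Set} {evA : A → X → ℤ} {evB : B → X → ℤ} {evC : C → X → ℤ} where

  *-InSpan-bilinear : (∀ a b → InSpan p evC (λ x → evA a x * evB b x)) →
                      ∀ {F G} → InSpan p evA F → InSpan p evB G → InSpan p evC (λ x → F x * G x)
  *-InSpan-bilinear atoms-InSpan (spanned-by L F≡L) (spanned-by K G≡K) =
    InSpan-resp (λ x → ≡mod-trans (*-cong-mod (F≡L x) (G≡K x)) (≡⇒≡mod (expand x)))
      (∑-InSpan L (λ (μ , a) → *-InSpan μ (∑-InSpan K (λ (ν , b) → *-InSpan ν (atoms-InSpan a b)))))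
    where
    open ≡-Reasoning
    rearrange : ∀ μ u ν v → μ * u * (ν * v) ≡ μ * (ν * (u * v))
    rearrange = solve-∀
    expand : ∀ x → lincomb evA L x * lincomb evB K x ≡
                   ∑[ (μ , a) ∈ L ] μ * (∑[ (ν , b) ∈ K ] ν * (evA a x * evB b x))
    expand x = begin
      lincomb evA L x * lincomb evB K x
        ≡⟨ ∑-*-∑ L K (λ (μ , a) → μ * evA a x) (λ (ν , b) → ν * evB b x) ⟩
      ∑[ (μ , a) ∈ L ] ∑[ (ν , b) ∈ K ] μ * evA a x * (ν * evB b x)
        ≡⟨ ∑-cong L (λ (μ , a) → ∑-cong K (λ (ν , b) → rearrange μ (evA a x) ν (evB b x))) ⟩
      ∑[ (μ , a) ∈ L ] ∑[ (ν , b) ∈ K ] μ * (ν * (evA a x * evB b x))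
        ≡⟨ ∑-cong L (λ (μ , a) → ∑-*ˡ μ K (λ (ν , b) → ν * (evA a x * evB b x))) ⟨
      ∑[ (μ , a) ∈ L ] μ * (∑[ (ν , b) ∈ K ] ν * (evA a x * evB b x)) ∎

weight : {A : Set} → Enumeration A → List (ℤ × A) → A → ℤ
weight E L a = ∑[ (μ , b) ∈ L ] μ * δ E b a

module _ {A X : Set} (E : Enumeration A) (ev : A → X → ℤ) where

  lincomb-collect : ∀ L x → lincomb ev L x ≡ ∑[ a ∈ elements E ] weight E L a * ev a x
  lincomb-collect L x = sym (begin
    ∑[ a ∈ elements E ] weight E L a * ev a x
      ≡⟨ ∑-cong (elements E) (λ a → ∑-*ʳ (ev a x) L (λ (μ , b) → μ * δ E b a)) ⟩
    ∑[ a ∈ elements E ] ∑[ (μ , b) ∈ L ] μ * δ E b a * ev a x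
      ≡⟨ ∑-swap (elements E) L (λ a (μ , b) → μ * δ E b a * ev a x) ⟩
    ∑[ (μ , b) ∈ L ] ∑[ a ∈ elements E ] μ * δ E b a * ev a x
      ≡⟨ ∑-cong L (λ (μ , b) → ∑-cong (elements E) (λ a → rearrange μ (δ E b a) (ev a x))) ⟩
    ∑[ (μ , b) ∈ L ] ∑[ a ∈ elements E ] μ * (ev a x * δ E b a)
      ≡⟨ ∑-cong L (λ (μ , b) → ∑-*ˡ μ (elements E) (λ a → ev a x * δ E b a)) ⟨
    ∑[ (μ , b) ∈ L ] μ * (∑[ a ∈ elements E ] ev a x * δ E b a)
      ≡⟨ ∑-cong L (λ (μ , b) → cong (μ *_) (sift E (λ a → ev a x) b)) ⟩
    lincomb ev L x ∎)
    where
    open ≡-Reasoning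
    rearrange : ∀ μ d e → μ * d * e ≡ μ * (e * d)
    rearrange = solve-∀

-- Indicators of pairs of congruences

Atom₂ : Set
Atom₂ = ℤ × ℤ × ℤ

evalAtom₂ : ℕ → Atom₂ → ℤ × ℤ → ℤ
evalAtom₂ N (α , β , t) (y , u) = 𝟙[ α * y + β * u ≡ t mod N ]

pairIndicator : ℕ → ℤ × ℤ → ℤ × ℤ → ℤ
pairIndicator N (a , b) (y , u) = 𝟙[ y ≡ a mod N ] * 𝟙[ u ≡ b mod N ]

evalAtom₂-constant : ∀ N x → evalAtom₂ N (0ℤ , 0ℤ , 0ℤ) x ≡ 1ℤ
evalAtom₂-constant N (y , u) = 𝟙-yes ≡mod-refl (0ℤ ≡? 0ℤ mod N)

∑-𝟙-degenerate : ∀ {q w} → w ≡ 0ℤ mod q → ∀ c →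
                 ∑[ t ∈ allFin q ] 𝟙[ + toℕ t * w ≡ c mod q ] ≡ + q * 𝟙[ 0ℤ ≡ c mod q ]
∑-𝟙-degenerate {q} {w} w≡0 c = begin
  ∑[ t ∈ allFin q ] 𝟙[ + toℕ t * w ≡ c mod q ]
    ≡⟨ ∑-cong (allFin q) (λ t → 𝟙≡mod-cong (tw≡0 t) ≡mod-refl) ⟩
  ∑[ t ∈ allFin q ] 𝟙[ 0ℤ ≡ c mod q ]
    ≡⟨ ∑-const (allFin q) 𝟙[ 0ℤ ≡ c mod q ] ⟩
  + length (allFin q) * 𝟙[ 0ℤ ≡ c mod q ]
    ≡⟨ cong (λ n → + n * 𝟙[ 0ℤ ≡ c mod q ]) (Listₚ.length-tabulate {n = q} id) ⟩
  + q * 𝟙[ 0ℤ ≡ c mod q ] ∎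
  where
  open ≡-Reasoning
  tw≡0 : ∀ t → + toℕ t * w ≡ 0ℤ mod q
  tw≡0 t = ≡mod-trans (*-cong-mod (≡mod-refl {a = + toℕ t}) w≡0) (≡⇒≡mod (ℤₚ.*-zeroʳ (+ toℕ t)))

module _ {q : ℕ} (pq : Prime q) where

  private instance
    q≢0 : NonZero q
    q≢0 = prime⇒nonZero pq

  ∑-𝟙-invertible : ∀ {w} → ¬ (w ≡ 0ℤ mod q) → ∀ c → ∑[ t ∈ allFin q ] 𝟙[ + toℕ t * w ≡ c mod q ] ≡ 1ℤ
  ∑-𝟙-invertible {w} w≢0 c = trans (∑-cong (allFin q) only-t₀) (sift (finᴱ q) (λ _ → 1ℤ) t₀)
    where
    z = proj₁ (prime⇒inverse pq w≢0)
    zw≡1 = proj₂ (prime⇒inverse pq w≢0)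
    reassociate : ∀ z c w → z * c * w ≡ c * (z * w)
    reassociate = solve-∀
    t₀ : Fin q
    t₀ = residue (z * c)
    t₀-solves : + toℕ t₀ * w ≡ c mod q
    t₀-solves = begin
      + toℕ t₀ * w   ≈⟨ *-cong-mod (residue-≡mod (z * c)) (≡mod-refl {a = w}) ⟩
      z * c * w      ≡⟨ reassociate z c w ⟩
      c * (z * w)    ≈⟨ *-cong-mod (≡mod-refl {a = c}) zw≡1 ⟩
      c * 1ℤ         ≡⟨ ℤₚ.*-identityʳ c ⟩
      c              ∎
      where open ≡mod-Reasoning q
    solves⇔ : ∀ t → (+ toℕ t * w ≡ c mod q) ⇔ (t₀ ≡ t)
    solves⇔ t = mk⇔
      (λ tw≡c → Finₚ.toℕ-injective (<∧≡mod⇒≡ (Finₚ.toℕ<n t₀) (Finₚ.toℕ<n t)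
                  (prime-*-cancelʳ pq w≢0 (≡mod-trans t₀-solves (≡mod-sym tw≡c)))))
      (λ { refl → t₀-solves })
    only-t₀ : ∀ t → 𝟙[ + toℕ t * w ≡ c mod q ] ≡ 1ℤ * 𝟙 (t₀ Finₚ.≟ t)
    only-t₀ t = trans (𝟙-⇔ (solves⇔ t) _ _) (sym (ℤₚ.*-identityˡ _))

  pairIndicator-counting : ∀ a b y u →
    (∑[ t ∈ allFin q ] 𝟙[ + toℕ t * (y - a) ≡ b - u mod q ]) + 𝟙[ y ≡ a mod q ] - 1ℤ
    ≡ + q * pairIndicator q (a , b) (y , u)
  pairIndicator-counting a b y u = by-cases (y ≡? a mod q)
    where
    open ≡-Reasoning
    by-cases : Dec (y ≡ a mod q) → _
    by-cases (yes y≡a) = begin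
      (∑[ t ∈ allFin q ] 𝟙[ + toℕ t * (y - a) ≡ b - u mod q ]) + 𝟙[ y ≡ a mod q ] - 1ℤ
        ≡⟨ cong₂ (λ s i → s + i - 1ℤ) (∑-𝟙-degenerate y-a≡0 (b - u)) 𝟙[y≡a]≡1 ⟩
      + q * 𝟙[ 0ℤ ≡ b - u mod q ] + 1ℤ - 1ℤ
        ≡⟨ cancel (+ q) 𝟙[ 0ℤ ≡ b - u mod q ] ⟩
      + q * (1ℤ * 𝟙[ 0ℤ ≡ b - u mod q ])
        ≡⟨ cong₂ (λ i j → + q * (i * j)) 𝟙[y≡a]≡1 (𝟙≡mod-difference (≡⇒≡mod (sym (flip u b)))) ⟨
      + q * (𝟙[ y ≡ a mod q ] * 𝟙[ u ≡ b mod q ]) ∎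
      where
      cancel : ∀ q i → q * i + 1ℤ - 1ℤ ≡ q * (1ℤ * i)
      cancel = solve-∀
      flip : ∀ u b → 0ℤ - (b - u) ≡ u - b
      flip = solve-∀
      y-a≡0 : y - a ≡ 0ℤ mod q
      y-a≡0 = ≡mod-difference (≡⇒≡mod (sym (ℤₚ.+-identityʳ (y - a)))) y≡a
      𝟙[y≡a]≡1 : 𝟙[ y ≡ a mod q ] ≡ 1ℤ
      𝟙[y≡a]≡1 = 𝟙-yes y≡a (y ≡? a mod q)
    by-cases (no y≢a) = begin
      (∑[ t ∈ allFin q ] 𝟙[ + toℕ t * (y - a) ≡ b - u mod q ]) + 𝟙[ y ≡ a mod q ] - 1ℤ
        ≡⟨ cong₂ (λ s i → s + i - 1ℤ) (∑-𝟙-invertible y-a≢0 (b - u)) 𝟙[y≡a]≡0 ⟩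
      0ℤ
        ≡⟨ ℤₚ.*-zeroʳ (+ q) ⟨
      + q * (0ℤ * 𝟙[ u ≡ b mod q ])
        ≡⟨ cong (λ i → + q * (i * 𝟙[ u ≡ b mod q ])) 𝟙[y≡a]≡0 ⟨
      + q * (𝟙[ y ≡ a mod q ] * 𝟙[ u ≡ b mod q ]) ∎
      where
      y-a≢0 : ¬ (y - a ≡ 0ℤ mod q)
      y-a≢0 = y≢a ∘′ ≡mod-difference (≡⇒≡mod (ℤₚ.+-identityʳ (y - a)))
      𝟙[y≡a]≡0 : 𝟙[ y ≡ a mod q ] ≡ 0ℤ
      𝟙[y≡a]≡0 = 𝟙-no y≢a (y ≡? a mod q)

  pairIndicator-identity : ∀ a b x →
    (∑[ t ∈ allFin q ] evalAtom₂ q (+ toℕ t , 1ℤ , b + + toℕ t * a) x)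
      + evalAtom₂ q (1ℤ , 0ℤ , a) x + - 1ℤ * evalAtom₂ q (0ℤ , 0ℤ , 0ℤ) x
    ≡ + q * pairIndicator q (a , b) x
  pairIndicator-identity a b x@(y , u) = trans
    (cong₂ _+_ (cong₂ _+_ (∑-cong (allFin q) λ t → 𝟙≡mod-difference (≡⇒≡mod (regroup (+ toℕ t) y u a b)))
                          (𝟙≡mod-difference (≡⇒≡mod (project y u a))))
               (cong (- 1ℤ *_) (evalAtom₂-constant q x)))
    (pairIndicator-counting a b y u)
    where
    regroup : ∀ t y u a b → t * y + 1ℤ * u - (b + t * a) ≡ t * (y - a) - (b - u)
    regroup = solve-∀
    project : ∀ y u a → 1ℤ * y + 0ℤ * u - a ≡ y - a
    project = solve-∀

pairIndicator-InSpan-prime : ∀ {p q} → Prime p → Prime q → ¬ p ∣ q → ∀ a b →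
                             InSpan p (evalAtom₂ q) (pairIndicator q (a , b))
pairIndicator-InSpan-prime {p} {q} pp pq p∤q a b = InSpan-resp scale-by-q⁻¹
  (*-InSpan v (+-InSpan (+-InSpan (∑-InSpan (allFin q) (λ t → atom-InSpan (+ toℕ t , 1ℤ , b + + toℕ t * a)))
                                  (atom-InSpan (1ℤ , 0ℤ , a)))
                        (*-InSpan (- 1ℤ) (atom-InSpan (0ℤ , 0ℤ , 0ℤ)))))
  where
  v = proj₁ (coprime⇒inverse (prime∤⇒coprime pp p∤q))
  vq≡1 = proj₂ (coprime⇒inverse (prime∤⇒coprime pp p∤q))
  scale-by-q⁻¹ : ∀ x → pairIndicator q (a , b) x ≡
    v * ((∑[ t ∈ allFin q ] evalAtom₂ q (+ toℕ t , 1ℤ , b + + toℕ t * a) x)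
         + evalAtom₂ q (1ℤ , 0ℤ , a) x + - 1ℤ * evalAtom₂ q (0ℤ , 0ℤ , 0ℤ) x) mod p
  scale-by-q⁻¹ x = begin
    P                ≡⟨ ℤₚ.*-identityˡ P ⟨
    1ℤ * P           ≈⟨ *-cong-mod (≡mod-sym vq≡1) (≡mod-refl {a = P}) ⟩
    v * + q * P      ≡⟨ ℤₚ.*-assoc v (+ q) P ⟩
    v * (+ q * P)    ≡⟨ cong (v *_) (pairIndicator-identity pq a b x) ⟨
    _                ∎
    where
    open ≡mod-Reasoning p
    P = pairIndicator q (a , b) x

mix : ℤ → ℤ → ℤ → ℤ
mix e s s′ = e * s + (1ℤ - e) * s′

module _ {N : ℕ} {e : ℤ} where

  mix-≡ˡ : e ≡ 1ℤ mod N → ∀ s s′ → mix e s s′ ≡ s mod N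
  mix-≡ˡ e≡1 s s′ = begin
    e * s + (1ℤ - e) * s′      ≈⟨ +-cong-mod (*-cong-mod e≡1 (≡mod-refl {a = s}))
                                     (*-cong-mod (+-cong-mod (≡mod-refl {a = 1ℤ}) (-‿cong-mod e≡1))
                                                 (≡mod-refl {a = s′})) ⟩
    1ℤ * s + (1ℤ - 1ℤ) * s′    ≡⟨ collapse s s′ ⟩
    s                          ∎
    where
    open ≡mod-Reasoning N
    collapse : ∀ s s′ → 1ℤ * s + (1ℤ - 1ℤ) * s′ ≡ s
    collapse = solve-∀

  mix-≡ʳ : e ≡ 0ℤ mod N → ∀ s s′ → mix e s s′ ≡ s′ mod N
  mix-≡ʳ e≡0 s s′ = begin
    e * s + (1ℤ - e) * s′      ≈⟨ +-cong-mod (*-cong-mod e≡0 (≡mod-refl {a = s}))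
                                     (*-cong-mod (+-cong-mod (≡mod-refl {a = 1ℤ}) (-‿cong-mod e≡0))
                                                 (≡mod-refl {a = s′})) ⟩
    0ℤ * s + (1ℤ - 0ℤ) * s′    ≡⟨ collapse s s′ ⟩
    s′                         ∎
    where
    open ≡mod-Reasoning N
    collapse : ∀ s s′ → 0ℤ * s + (1ℤ - 0ℤ) * s′ ≡ s′
    collapse = solve-∀

crt-idempotent : ∀ {q M} → Coprime q M → Σ ℤ λ e → (e ≡ 1ℤ mod q) × (e ≡ 0ℤ mod M)
crt-idempotent c = let u , uM≡1 = coprime⇒inverse c in u * + _ , uM≡1 , multiple≡0-mod u

mixAtoms : ℤ → Atom₂ → Atom₂ → Atom₂
mixAtoms e (α , β , t) (α′ , β′ , t′) = mix e α α′ , mix e β β′ , mix e t t′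

module _ {q M : ℕ} (q⊥M : Coprime q M) where

  pairIndicator-*-coprime : ∀ a b x →
    pairIndicator (q ℕ.* M) (a , b) x ≡ pairIndicator q (a , b) x * pairIndicator M (a , b) x
  pairIndicator-*-coprime a b (y , u) = trans
    (cong₂ _*_ (𝟙≡mod-*-coprime q⊥M y a) (𝟙≡mod-*-coprime q⊥M u b))
    (interchange 𝟙[ y ≡ a mod q ] 𝟙[ y ≡ a mod M ] 𝟙[ u ≡ b mod q ] 𝟙[ u ≡ b mod M ])
    where
    interchange : ∀ i j k l → i * j * (k * l) ≡ i * k * (j * l)
    interchange = solve-∀

  -- Chinese remaindering: modulo q the mixed atom is A, modulo M it is B.
  evalAtom₂-mix : ∀ {e} → e ≡ 1ℤ mod q → e ≡ 0ℤ mod M → ∀ A B x →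
    evalAtom₂ q A x * evalAtom₂ M B x ≡ evalAtom₂ (q ℕ.* M) (mixAtoms e A B) x
  evalAtom₂-mix {e} e≡1 e≡0 (α , β , t) (α′ , β′ , t′) (y , u) = sym (begin
    𝟙[ mix e α α′ * y + mix e β β′ * u ≡ mix e t t′ mod q ℕ.* M ]
      ≡⟨ 𝟙≡mod-cong (≡⇒≡mod (mix-linear e α α′ β β′ y u)) ≡mod-refl ⟩
    𝟙[ mix e z z′ ≡ mix e t t′ mod q ℕ.* M ]
      ≡⟨ 𝟙≡mod-*-coprime q⊥M (mix e z z′) (mix e t t′) ⟩
    𝟙[ mix e z z′ ≡ mix e t t′ mod q ] * 𝟙[ mix e z z′ ≡ mix e t t′ mod M ]
      ≡⟨ cong₂ _*_ (𝟙≡mod-cong (mix-≡ˡ e≡1 z z′) (mix-≡ˡ e≡1 t t′))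
                   (𝟙≡mod-cong (mix-≡ʳ e≡0 z z′) (mix-≡ʳ e≡0 t t′)) ⟩
    𝟙[ z ≡ t mod q ] * 𝟙[ z′ ≡ t′ mod M ] ∎)
    where
    open ≡-Reasoning
    z = α * y + β * u
    z′ = α′ * y + β′ * u
    mix-linear : ∀ e α α′ β β′ y u →
      (e * α + (1ℤ - e) * α′) * y + (e * β + (1ℤ - e) * β′) * u
      ≡ e * (α * y + β * u) + (1ℤ - e) * (α′ * y + β′ * u)
    mix-linear = solve-∀

pairIndicator-InSpan-product : ∀ {p} → Prime p → ∀ {qs} → All Prime qs →
                               SquareFree (product qs) → ¬ p ∣ product qs → ∀ a b →
                               InSpan p (evalAtom₂ (product qs)) (pairIndicator (product qs) (a , b))
pairIndicator-InSpan-product pp [] _ _ a b =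
  InSpan-resp (λ x → ≡⇒≡mod (trivial-modulus x)) (atom-InSpan (0ℤ , 0ℤ , 0ℤ))
  where
  trivial-modulus : ∀ x → pairIndicator 1 (a , b) x ≡ evalAtom₂ 1 (0ℤ , 0ℤ , 0ℤ) x
  trivial-modulus x@(y , u) =
    trans (cong₂ _*_ (𝟙≡mod-1 y a) (𝟙≡mod-1 u b)) (sym (evalAtom₂-constant 1 x))
pairIndicator-InSpan-product {p} pp {q ∷ qs} (pq ∷ pqs) sf p∤qM a b =
  InSpan-resp (λ x → ≡⇒≡mod (pairIndicator-*-coprime q⊥M a b x))
    (*-InSpan-bilinear mixed-atom-InSpan
      (pairIndicator-InSpan-prime pp pq (λ p∣q → p∤qM (ℕ∣.∣-trans p∣q (ℕ∣.m∣m*n M))) a b)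
      (pairIndicator-InSpan-product pp pqs sf-M (λ p∣M → p∤qM (ℕ∣.∣-trans p∣M M∣qM)) a b))
  where
  M = product qs
  M∣qM : M ∣ q ℕ.* M
  M∣qM = ℕ∣.n∣m*n q
  sf-M : SquareFree M
  sf-M d dd∣M = sf d (ℕ∣.∣-trans dd∣M M∣qM)
  q⊥M : Coprime q M
  q⊥M = prime∤⇒coprime pq (λ q∣M → ¬prime[1] (subst Prime (sf q (ℕ∣.*-monoʳ-∣ q q∣M)) pq))
  mixed-atom-InSpan : ∀ A B → InSpan p (evalAtom₂ (q ℕ.* M)) (λ x → evalAtom₂ q A x * evalAtom₂ M B x)
  mixed-atom-InSpan A B with crt-idempotent q⊥M
  ... | e , e≡1 , e≡0 = InSpan-resp (λ x → ≡⇒≡mod (evalAtom₂-mix q⊥M e≡1 e≡0 A B x)) (atom-InSpan (mixAtoms e A B))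

pairIndicator-InSpan : ∀ {p N} .{{_ : NonZero N}} → Prime p → SquareFree N → ¬ p ∣ N →
                       ∀ a b → InSpan p (evalAtom₂ N) (pairIndicator N (a , b))
pairIndicator-InSpan {p} {N} pp sf p∤N a b =
  subst (λ M → InSpan p (evalAtom₂ M) (pairIndicator M (a , b))) (sym N≡∏)
    (pairIndicator-InSpan-product pp (factorsPrime (factorise N))
                                  (subst SquareFree N≡∏ sf) (subst (λ M → ¬ p ∣ M) N≡∏ p∤N) a b)
  where
  N≡∏ = isFactorisation (factorise N)

-- MOD gates

weightedSum : ∀ {n} → (Fin n → ℕ) → Input n → ℕ
weightedSum {n} w x = sumFin n (λ i → w i ℕ.* b2n (x i))

weightedSum-linear : ∀ {n} c (w w′ : Fin n → ℕ) x →
  weightedSum (λ i → c ℕ.* w i ℕ.+ w′ i) x ≡ c ℕ.* weightedSum w x ℕ.+ weightedSum w′ x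
weightedSum-linear {zero}  c w w′ x = sym (cong (ℕ._+ 0) (ℕₚ.*-zeroʳ c))
weightedSum-linear {suc n} c w w′ x = trans
  (cong ((c ℕ.* w zero ℕ.+ w′ zero) ℕ.* b2n (x zero) ℕ.+_) (weightedSum-linear c (w ∘′ suc) (w′ ∘′ suc) (x ∘′ suc)))
  (distribute c (w zero) (w′ zero) (b2n (x zero)) (weightedSum (w ∘′ suc) (x ∘′ suc))
              (weightedSum (w′ ∘′ suc) (x ∘′ suc)))
  where
  distribute : ∀ c a a′ b s s′ →
    (c ℕ.* a ℕ.+ a′) ℕ.* b ℕ.+ (c ℕ.* s ℕ.+ s′) ≡ c ℕ.* (a ℕ.* b ℕ.+ s) ℕ.+ (a′ ℕ.* b ℕ.+ s′)
  distribute = ℕSolver.solve-∀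

weightedSum-zero : ∀ {n} (x : Input n) → weightedSum (λ _ → 0) x ≡ 0
weightedSum-zero {zero}  x = refl
weightedSum-zero {suc n} x = weightedSum-zero (x ∘′ suc)

b2n-∧ : ∀ b c → + b2n (b ∧ c) ≡ + b2n b * + b2n c
b2n-∧ true  c = sym (ℤₚ.*-identityˡ (+ b2n c))
b2n-∧ false c = refl

b2n-does : ∀ {P : Set} (p? : Dec P) → + b2n (does p?) ≡ 𝟙 p?
b2n-does (yes _) = refl
b2n-does (no _)  = refl

module _ {m n : ℕ} where

  linearForm : (gs : List (ModGate m n)) → Vec ℤ (length gs) → Input n → ℤ
  linearForm []       []       x = 0ℤ
  linearForm (g ∷ gs) (c ∷ cs) x = c * + weightedSum (ModGate.wires g) x + linearForm gs cs x

  linearForm-scale : ∀ (gs : List (ModGate m n)) β cs x →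
                     linearForm gs (Vec.map (β *_) cs) x ≡ β * linearForm gs cs x
  linearForm-scale []       β []       x = sym (ℤₚ.*-zeroʳ β)
  linearForm-scale (g ∷ gs) β (c ∷ cs) x = trans
    (cong (_+_ (β * c * + weightedSum (ModGate.wires g) x)) (linearForm-scale gs β cs x))
    (distribute β c (+ weightedSum (ModGate.wires g) x) (linearForm gs cs x))
    where
    distribute : ∀ β c s l → β * c * s + β * l ≡ β * (c * s + l)
    distribute = solve-∀

  GateAtom : List (ModGate m n) → Set
  GateAtom gs = Vec ℤ (length gs) × ℤ

  evalGateAtom : (gs : List (ModGate m n)) → GateAtom gs → Input n → ℤ
  evalGateAtom gs (c , r) x = 𝟙[ linearForm gs c x ≡ r mod m ]

module _ {m n : ℕ} .{{_ : NonZero m}} where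

  andValue : List (ModGate m n) → Input n → ℤ
  andValue gs x = + b2n (allL (λ g → evalMod g x) gs)

  residueAtom : ModGate m n → Fin m → Input n → ℤ
  residueAtom g a x = 𝟙[ + weightedSum (ModGate.wires g) x ≡ + toℕ a mod m ]

  accept-InSpan : ∀ {p} g → InSpan p (residueAtom g) (λ x → + b2n (evalMod g x))
  accept-InSpan g = spanned-by (map (λ a → + b2n (ModGate.accept g a) , a) (allFin m)) (λ x → ≡⇒≡mod (begin
    + b2n (evalMod g x)
      ≡⟨ sift (finᴱ m) (λ a → + b2n (ModGate.accept g a)) (residue (+ weightedSum (ModGate.wires g) x)) ⟨
    ∑[ a ∈ allFin m ] + b2n (ModGate.accept g a) * 𝟙 (residue (+ weightedSum (ModGate.wires g) x) Finₚ.≟ a)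
      ≡⟨ ∑-cong (allFin m) (λ a → cong (+ b2n (ModGate.accept g a) *_)
           (𝟙-⇔ residue≡⇔≡mod (residue (+ weightedSum (ModGate.wires g) x) Finₚ.≟ a) (_ ≡? _ mod m))) ⟩
    ∑[ a ∈ allFin m ] + b2n (ModGate.accept g a) * residueAtom g a x
      ≡⟨ ∑-map (λ a → + b2n (ModGate.accept g a) , a) (allFin m) (λ (μ , a) → μ * residueAtom g a x) ⟨
    lincomb (residueAtom g) (map (λ a → + b2n (ModGate.accept g a) , a) (allFin m)) x ∎))
    where open ≡-Reasoning

module _ {p m n : ℕ} .{{_ : NonZero m}} (pp : Prime p) (sf : SquareFree m) (p∤m : ¬ p ∣ m) where

  AND-InSpan : ∀ gs → InSpan p (evalGateAtom gs) (andValue {m} {n} gs)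
  AND-InSpan [] = InSpan-resp (λ x → ≡⇒≡mod (sym (𝟙-yes ≡mod-refl (0ℤ ≡? 0ℤ mod m)))) (atom-InSpan ([] , 0ℤ))
  AND-InSpan (g ∷ gs) = InSpan-resp (λ x → ≡⇒≡mod (b2n-∧ (evalMod g x) (allL (λ g′ → evalMod g′ x) gs)))
    (*-InSpan-bilinear pair-InSpan (accept-InSpan g) (AND-InSpan gs))
    where
    y : Input n → ℤ
    y x = + weightedSum (ModGate.wires g) x
    -- [y ≡ a] · [⟨c, s⟩ ≡ r] is the pair indicator at (y, ⟨c, s⟩), and an atom α y + β ⟨c, s⟩ ≡ t
    -- of that point is the atom (α ∷ β c, t) of g ∷ gs.
    pair-InSpan : ∀ a (cr : GateAtom gs) →
                  InSpan p (evalGateAtom (g ∷ gs)) (λ x → residueAtom g a x * evalGateAtom gs cr x)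
    pair-InSpan a (c , r) =
      InSpan-subst (λ (α , β , t) → α ∷ Vec.map (β *_) c , t) (λ x → y x , linearForm gs c x)
      (λ (α , β , t) x → 𝟙≡mod-cong (≡⇒≡mod (cong (_+_ (α * y x)) (sym (linearForm-scale gs β c x)))) ≡mod-refl)
      (pairIndicator-InSpan pp sf p∤m (+ toℕ a) r)

module _ {m n : ℕ} .{{_ : NonZero m}} where

  combineWires : (gs : List (ModGate m n)) → Vec (Fin m) (length gs) → Fin n → ℕ
  combineWires []       []       i = 0
  combineWires (g ∷ gs) (c ∷ cs) i = toℕ c ℕ.* ModGate.wires g i ℕ.+ combineWires gs cs i

  CanonicalAtom : List (ModGate m n) → Set
  CanonicalAtom gs = Vec (Fin m) (length gs) × Fin m

  atomGate : (gs : List (ModGate m n)) → CanonicalAtom gs → ModGate m n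
  atomGate gs (cs , r) = modGate (combineWires gs cs) (λ j → does (j Finₚ.≟ r))

  canonical : ∀ {gs : List (ModGate m n)} → GateAtom gs → CanonicalAtom gs
  canonical (c , r) = Vec.map residue c , residue r

  weightedSum-combineWires : ∀ (gs : List (ModGate m n)) cs x →
    + weightedSum (combineWires gs cs) x ≡ linearForm gs (Vec.map (λ a → + toℕ a) cs) x
  weightedSum-combineWires []       []       x = cong +_ (weightedSum-zero x)
  weightedSum-combineWires (g ∷ gs) (c ∷ cs) x = begin
    + weightedSum (λ i → toℕ c ℕ.* ModGate.wires g i ℕ.+ combineWires gs cs i) x
      ≡⟨ cong +_ (weightedSum-linear (toℕ c) (ModGate.wires g) (combineWires gs cs) x) ⟩
    + (toℕ c ℕ.* weightedSum (ModGate.wires g) x ℕ.+ weightedSum (combineWires gs cs) x)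
      ≡⟨ ℤₚ.pos-+ (toℕ c ℕ.* weightedSum (ModGate.wires g) x) (weightedSum (combineWires gs cs) x) ⟩
    + (toℕ c ℕ.* weightedSum (ModGate.wires g) x) + + weightedSum (combineWires gs cs) x
      ≡⟨ cong₂ _+_ (ℤₚ.pos-* (toℕ c) (weightedSum (ModGate.wires g) x)) (weightedSum-combineWires gs cs x) ⟩
    linearForm (g ∷ gs) (Vec.map (λ a → + toℕ a) (c ∷ cs)) x ∎
    where open ≡-Reasoning

  linearForm-residues : ∀ (gs : List (ModGate m n)) c x →
    linearForm gs (Vec.map (λ a → + toℕ a) (Vec.map residue c)) x ≡ linearForm gs c x mod m
  linearForm-residues []       []       x = ≡mod-refl
  linearForm-residues (g ∷ gs) (c ∷ cs) x =
    +-cong-mod (*-cong-mod (residue-≡mod c) (≡mod-refl {a = + weightedSum (ModGate.wires g) x}))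
               (linearForm-residues gs cs x)

  evalGateAtom-canonical : ∀ (gs : List (ModGate m n)) (a : GateAtom gs) x →
    evalGateAtom gs a x ≡ + b2n (evalMod (atomGate gs (canonical {gs} a)) x)
  evalGateAtom-canonical gs (c , r) x = sym (begin
    + b2n (does (residue (+ S) Finₚ.≟ residue r))
      ≡⟨ b2n-does (residue (+ S) Finₚ.≟ residue r) ⟩
    𝟙 (residue (+ S) Finₚ.≟ residue r)
      ≡⟨ 𝟙-⇔ residue≡⇔≡mod (residue (+ S) Finₚ.≟ residue r) (_ ≡? _ mod m) ⟩
    𝟙[ + S ≡ + toℕ (residue r) mod m ]
      ≡⟨ 𝟙≡mod-cong (≡mod-trans (≡⇒≡mod (weightedSum-combineWires gs (Vec.map residue c) x))
                                (linearForm-residues gs c x))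
                    (residue-≡mod r) ⟩
    𝟙[ linearForm gs c x ≡ r mod m ] ∎)
    where
    open ≡-Reasoning
    S = weightedSum (combineWires gs (Vec.map residue c)) x

  canonicalᴱ : ∀ gs → Enumeration (CanonicalAtom gs)
  canonicalᴱ gs = vecᴱ (finᴱ m) (length gs) ×ᴱ finᴱ m

length-vecᴱ : ∀ {A} (E : Enumeration A) k → length (elements (vecᴱ E k)) ≡ length (elements E) ^ k
length-vecᴱ E zero    = refl
length-vecᴱ E (suc k) = trans (length-cartesianProductWith _∷_ (elements E) (elements (vecᴱ E k)))
                              (cong (length (elements E) ℕ.*_) (length-vecᴱ E k))

+-sumFin-lookup : ∀ {A : Set} (L : List A) (f : A → ℕ) →
                  + sumFin (length L) (λ i → f (lookup L i)) ≡ ∑[ a ∈ L ] + f a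
+-sumFin-lookup []      f = refl
+-sumFin-lookup (a ∷ L) f = trans (ℤₚ.pos-+ (f a) _) (cong (_+_ (+ f a)) (+-sumFin-lookup L f))

b2n<prime : ∀ {p} → Prime p → ∀ b → b2n b ℕ.< p
b2n<prime pp b = ℕₚ.≤-<-trans (b2n≤1 b) (ℕ.nonTrivial⇒n>1 _ {{prime⇒nonTrivial pp}})
  where
  b2n≤1 : ∀ b → b2n b ℕ.≤ 1
  b2n≤1 true  = ℕₚ.≤-refl
  b2n≤1 false = ℕ.z≤n

module _ {m p n : ℕ} .{{_ : NonZero m}} .{{_ : NonZero p}} (pp : Prime p) (sf : SquareFree m) (p∤m : ¬ p ∣ m)
         (gs : List (ModGate m n)) where

  private
    E = canonicalᴱ gs

    evalCanonical : CanonicalAtom gs → Input n → ℤ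
    evalCanonical a x = + b2n (evalMod (atomGate gs a) x)

    AND-InSpan-canonical : InSpan p evalCanonical (andValue gs)
    AND-InSpan-canonical =
      InSpan-subst (canonical {gs = gs}) id (evalGateAtom-canonical gs) (AND-InSpan pp sf p∤m gs)

    coefficient : CanonicalAtom gs → ℕ
    coefficient a = toℕ (residue {p} (weight E (combination AND-InSpan-canonical) a))

  modSigmaCircuit : ModSigmaCircuit m p n
  modSigmaCircuit = modSigma (length (elements E))
    (λ i → atomGate gs (lookup (elements E) i)) (λ i → coefficient (lookup (elements E) i)) 0

  modSigmaCircuit-size : ModSigmaCircuit.size modSigmaCircuit ≡ m ^ length gs ℕ.* m
  modSigmaCircuit-size = trans (length-cartesianProductWith _,_ (elements (vecᴱ (finᴱ m) (length gs))) (allFin m))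
    (cong₂ ℕ._*_ (trans (length-vecᴱ (finᴱ m) (length gs))
                        (cong (ℕ._^ length gs) (Listₚ.length-tabulate {n = m} id)))
                 (Listₚ.length-tabulate {n = m} id))

  modSigmaCircuit-correct : ∀ x → evalModSigma modSigmaCircuit x ≡ b2n (allL (λ g → evalMod g x) gs)
  modSigmaCircuit-correct x = trans (cong (ℕ._% p) (ℕₚ.+-identityʳ _)) (%-≡mod⇒≡ (b2n<prime pp _) (begin
    + sumFin (length (elements E))
             (λ i → coefficient (lookup (elements E) i) ℕ.* b2n (evalMod (atomGate gs (lookup (elements E) i)) x))
      ≡⟨ +-sumFin-lookup (elements E) (λ a → coefficient a ℕ.* b2n (evalMod (atomGate gs a) x)) ⟩
    ∑[ a ∈ elements E ] + (coefficient a ℕ.* b2n (evalMod (atomGate gs a) x))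
      ≡⟨ ∑-cong (elements E) (λ a → ℤₚ.pos-* (coefficient a) (b2n (evalMod (atomGate gs a) x))) ⟩
    ∑[ a ∈ elements E ] + coefficient a * evalCanonical a x
      ≈⟨ ∑-cong-mod (elements E) (λ a → *-cong-mod (residue-≡mod (weight E L a))
                                                   (≡mod-refl {a = evalCanonical a x})) ⟩
    ∑[ a ∈ elements E ] weight E L a * evalCanonical a x
      ≡⟨ lincomb-collect E evalCanonical L x ⟨
    lincomb evalCanonical L x
      ≈⟨ represents AND-InSpan-canonical x ⟨
    andValue gs x ∎))
    where
    open ≡mod-Reasoning p
    L = combination AND-InSpan-canonical

modAnd⇒modSigma : ∀ {m p d n} .{{_ : NonZero m}} .{{_ : NonZero p}} → SquareFree m → Prime p → ¬ p ∣ m →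
  (c : ModAndCircuit m d n) →
  Σ (ModSigmaCircuit m p n) λ c′ →
    (ModSigmaCircuit.size c′ ℕ.≤ m ^ (d ℕ.+ 1)) × (∀ x → evalModSigma c′ x ≡ b2n (evalModAnd c x))
modAnd⇒modSigma {m} {p} {d} sf pp p∤m (modAnd gs k≤d) =
  modSigmaCircuit pp sf p∤m gs , size-bound , modSigmaCircuit-correct pp sf p∤m gs
  where
  open ℕₚ.≤-Reasoning
  size-bound = begin
    ModSigmaCircuit.size (modSigmaCircuit pp sf p∤m gs) ≡⟨ modSigmaCircuit-size pp sf p∤m gs ⟩
    m ^ length gs ℕ.* m                               ≡⟨ ℕₚ.*-comm (m ^ length gs) m ⟩
    m ℕ.* m ^ length gs                               ≤⟨ ℕₚ.*-monoʳ-≤ m (ℕₚ.^-monoʳ-≤ m k≤d) ⟩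
    m ℕ.* m ^ d                                       ≡⟨ cong (m ^_) (ℕₚ.+-comm 1 d) ⟩
    m ^ (d ℕ.+ 1)                                     ∎

lemma9p2 : Σ ℕ λ C →
    (m p d n : ℕ) → .{{_ : NonZero m}} → .{{_ : NonZero p}} →
    SquareFree m → Prime p → ¬ (p ∣ m) →
    (c : ModAndCircuit m d n) →
    Σ (ModSigmaCircuit m p n) λ c′ →
    (ModSigmaCircuit.size c′ ℕ.≤ C ℕ.* m ^ (d ℕ.+ 1)) ×
    (∀ x → evalModSigma c′ x ≡ b2n (evalModAnd c x))
lemma9p2 = 1 , λ m p d n sf pp p∤m c →
  let c′ , size≤ , correct = modAnd⇒modSigma sf pp p∤m c
  in c′ , ℕₚ.≤-trans size≤ (ℕₚ.≤-reflexive (sym (ℕₚ.*-identityˡ (m ^ (d ℕ.+ 1))))) , correct
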